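{- For every propositional theory $\Gamma$, every $x\in\mathtt{VAR}$ and every three-valued Gödel interpretation $\bm{m}$: if $\bm{m}$ is an equilibrium model of $\Gamma\cup\{\neg\neg x\}$, then $\bm{m}$ is an equilibrium model of $\Gamma\cup\{x\}$.
   Context: Fix a nonempty set $\mathtt{VAR}$ of atoms. Formulas are generated by $\varphi,\psi ::= p \mid \bot \mid \varphi\wedge\psi \mid \varphi\vee\psi \mid \varphi\to\psi$ with $p\in\mathtt{VAR}$; $\neg\varphi$ abbreviates $\varphi\to\bot$; a theory is a set of formulas. A three-valued Gödel ($G_3$) interpretation is a map $\bm{m}:\mathtt{VAR}\to\{0,\tfrac12,1\}$, extended to formulas by $\bm{m}(\bot)=0$, $\bm{m}(\varphi\wedge\psi)=\min\{\bm{m}(\varphi),\bm{m}(\psi)\}$, $\bm{m}(\varphi\vee\psi)=\max\{\bm{m}(\varphi),\bm{m}(\psi)\}$, $\bm{m}(\varphi\to\psi)=1$ if $\bm{m}(\varphi)\le\bm{m}(\psi)$ and $=\bm{m}(\psi)$ otherwise, and to theories by $\bm{m}(\Gamma)=\min\{\bm{m}(\varphi)\mid\varphi\in\Gamma\}$. The crisp interpretation $\bm{m}^{c}$ is given by $\bm{m}^{c}(p)=1$ if $\bm{m}(p)=\tfrac12$ and $\bm{m}^{c}(p)=\bm{m}(p)$ otherwise. Write $\bm{m}\trianglelefteq\bm{m}'$ if $\bm{m}^{c}=\bm{m}'^{c}$ and $\bm{m}(p)\le\bm{m}'(p)$ for all $p\in\mathtt{VAR}$, and $\bm{m}\triangleleft\bm{m}'$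 if $\bm{m}\trianglelefteq\bm{m}'$ and $\bm{m}\neq\bm{m}'$. An equilibrium model of $\Gamma$ is an interpretation $\bm{m}$ with $\bm{m}=\bm{m}^{c}$ and $\bm{m}(\Gamma)=1$ such that there is no $\bm{m}'\triangleleft\bm{m}$ with $\bm{m}'(\Gamma)=1$. -}

module Defs where

open import Data.Product using (_×_; Σ)
open import Data.Sum using (_⊎_)
open import Relation.Binary.PropositionalEquality using (_≡_)
open import Relation.Nullary using (¬_)
open import Level using (Level; suc; _⊔_)

-- Three truth values 0 < 1/2 < 1
data G3 : Set where
  v0 vh v1 : G3

data _≤₃_ : G3 → G3 → Set where
  0≤ : ∀ {a} → v0 ≤₃ a
  h≤h : vh ≤₃ vh
  h≤1 : vh ≤₃ v1
  1≤1 : v1 ≤₃ v1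

min₃ : G3 → G3 → G3
min₃ v0 _ = v0
min₃ vh v0 = v0
min₃ vh _ = vh
min₃ v1 b = b

max₃ : G3 → G3 → G3
max₃ v0 b = b
max₃ vh v1 = v1
max₃ vh _ = vh
max₃ v1 _ = v1

-- Gödel implication: 1 if a ≤ b, otherwise b
imp₃ : G3 → G3 → G3
imp₃ v0 _ = v1
imp₃ vh v0 = v0
imp₃ vh _ = v1
imp₃ v1 b = b

module _ {ℓ : Level} (VAR : Set ℓ) where

  data Formula : Set ℓ where
    atom : VAR → Formula
    ⊥f   : Formula
    _∧f_ _∨f_ _⇒f_ : Formula → Formula → Formula

  ¬f : Formula → Formula
  ¬f φ = φ ⇒f ⊥f

  Theory : Set (suc ℓ)
  Theory = Formula → Set ℓ

  _∪｛_｝ : Theory → Formula → Theory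
  (Γ ∪｛ φ ｝) ψ = Γ ψ ⊎ (ψ ≡ φ)

  Interp : Set ℓ
  Interp = VAR → G3

  eval : Interp → Formula → G3
  eval m (atom p) = m p
  eval m ⊥f = v0
  eval m (φ ∧f ψ) = min₃ (eval m φ) (eval m ψ)
  eval m (φ ∨f ψ) = max₃ (eval m φ) (eval m ψ)
  eval m (φ ⇒f ψ) = imp₃ (eval m φ) (eval m ψ)

  -- m(Γ) = 1, i.e. the minimum over Γ equals 1 (every member gets value 1)
  Sat : Interp → Theory → Set ℓ
  Sat m Γ = ∀ φ → Γ φ → eval m φ ≡ v1

  crispV : G3 → G3
  crispV vh = v1
  crispV a = a

  crisp : Interp → Interp
  crisp m p = crispV (m p)

  _⊴_ : Interp → Interp → Set ℓ
  m ⊴ m' = (∀ p → crisp m p ≡ crisp m' p) × (∀ p → m p ≤₃ m' p)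

  _◁_ : Interp → Interp → Set ℓ
  m ◁ m' = (m ⊴ m') × ¬ (∀ p → m p ≡ m' p)

  EquilibriumModel : Theory → Interp → Set ℓ
  EquilibriumModel Γ m =
    (∀ p → m p ≡ crisp m p) × Sat m Γ ×
    ¬ (Σ Interp λ m' → (m' ◁ m) × Sat m' Γ)

{-# OPTIONS --safe #-}
-- Over a crisp interpretation ¬¬x has value 1 exactly when x does, so m satisfies
-- Γ ∪ {x}; and since x ⊨ ¬¬x in G₃, every model of Γ ∪ {x} is a model of
-- Γ ∪ {¬¬x}, so a strictly smaller model of the former would refute minimality
-- of m for the latter.
module Submission where

open import Defs
open import Level using (Level)
open import Data.Product using (_,_)
open import Data.Sum using (inj₁; inj₂)
open import Relation.Binary.PropositionalEquality using (_≡_; refl)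

imp₃-¬¬-crisp : ∀ {ℓ} {VAR : Set ℓ} a → a ≡ crispV VAR a →
                imp₃ (imp₃ a v0) v0 ≡ v1 → a ≡ v1
imp₃-¬¬-crisp v0 _ ()
imp₃-¬¬-crisp vh () _
imp₃-¬¬-crisp v1 _ _ = refl

imp₃-¬¬-v1 : ∀ {a} → a ≡ v1 → imp₃ (imp₃ a v0) v0 ≡ v1
imp₃-¬¬-v1 refl = refl

module _ {ℓ : Level} (VAR : Set ℓ) where

  Sat-∪-replace : ∀ {m Γ φ ψ} → Sat VAR m (_∪｛_｝ VAR Γ φ) →
                  (eval VAR m φ ≡ v1 → eval VAR m ψ ≡ v1) →
                  Sat VAR m (_∪｛_｝ VAR Γ ψ)
  Sat-∪-replace sat _     χ (inj₁ χ∈Γ) = sat χ (inj₁ χ∈Γ)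
  Sat-∪-replace sat φ⇒ψ _ (inj₂ refl) = φ⇒ψ (sat _ (inj₂ refl))

  EquilibriumModel-strengthen : ∀ {Γ Δ m} →
    (∀ m′ → Sat VAR m′ Δ → Sat VAR m′ Γ) → Sat VAR m Δ →
    EquilibriumModel VAR Γ m → EquilibriumModel VAR Δ m
  EquilibriumModel-strengthen Δ⊨Γ satΔ (crisp-m , _ , minimal) =
    crisp-m , satΔ , λ { (m′ , m′◁m , m′⊨Δ) → minimal (m′ , m′◁m , Δ⊨Γ m′ m′⊨Δ) }

proposition6 : ∀ {ℓ : Level} (VAR : Set ℓ) → VAR →
    (Γ : Theory VAR) (x : VAR) (m : Interp VAR) →
    EquilibriumModel VAR (_∪｛_｝ VAR Γ (¬f VAR (¬f VAR (atom x)))) m →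
    EquilibriumModel VAR (_∪｛_｝ VAR Γ (atom x)) m
proposition6 VAR _ Γ x m eq@(crisp-m , sat , _) =
  EquilibriumModel-strengthen VAR x⊨¬¬x
    (Sat-∪-replace VAR sat (imp₃-¬¬-crisp {VAR = VAR} (m x) (crisp-m x))) eq
  where
  x⊨¬¬x : ∀ m′ → Sat VAR m′ (_∪｛_｝ VAR Γ (atom x)) →
          Sat VAR m′ (_∪｛_｝ VAR Γ (¬f VAR (¬f VAR (atom x))))
  x⊨¬¬x m′ sat′ = Sat-∪-replace VAR sat′ imp₃-¬¬-v1
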